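{- Let $n=2m+1$ be odd with $m\ge1$, and let $\alpha,\beta,\gamma$ be nonzero elements of $\mathbb{F}_{2^n}$ such that $\gamma\notin\{x^2+\alpha x: x\in\mathbb{F}_{2^n}\}$ and $\mathrm{Tr}(\beta\alpha)=1$. Let $K(x)=x^6+\alpha x^3+\gamma\,\mathrm{Tr}(\alpha^{ -3}x^9+\beta x^3)$. Then the image of $K$ is a $(2^{2m},2,2^{2m},2^{2m-1})$ relative difference set in $(\mathbb{F}_{2^n},+)$ relative to the subgroup $N=\{0,\gamma\}$.
   Context: $\mathrm{Tr}$ denotes the absolute trace from $\mathbb{F}_{2^n}$ to $\mathbb{F}_2$. Let $G$ be a finite group of order $m'n'$ with a normal subgroup $N$ of order $n'$. A $k'$-subset $R\subseteq G$ is an $(m',n',k',\lambda)$ relative difference set relative to $N$ if the list of differences $r-r'$ with $r,r'\in R$, $r\ne r'$, covers every element of $G\setminus N$ exactly $\lambda$ times and covers no element of $N\setminus\{0\}$. -}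

module Defs where

open import Level using (0ℓ)
open import Data.Nat using (ℕ; zero; suc)
import Data.Nat as Nat
open import Data.Fin using (Fin)
open import Data.Product using (Σ; ∃; _×_; _,_; proj₁; proj₂)
open import Relation.Nullary using (¬_)
open import Relation.Binary.PropositionalEquality using (_≡_)
open import Algebra.Bundles using (CommutativeRing; AbelianGroup)

HasSize : (A : Set) → (A → A → Set) → ℕ → Set
HasSize A _~_ k =
  Σ (Fin k → A) λ f →
    (∀ i j → f i ~ f j → i ≡ j) × (∀ a → ∃ λ i → f i ~ a)

-- A finite field of order 2^n (any such field is F_{2^n} up to isomorphism).
record Field2^ (n : ℕ) : Set₁ where
  field
    cring : CommutativeRing 0ℓ 0ℓ
  open CommutativeRing cring public
  field
    _⁻¹      : Carrier → Carrier
    1≉0      : ¬ (1# ≈ 0#)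
    inverseʳ : ∀ x → ¬ (x ≈ 0#) → (x * (x ⁻¹)) ≈ 1#
    size     : HasSize Carrier _≈_ (2 Nat.^ n)

  pow : Carrier → ℕ → Carrier
  pow x zero    = 1#
  pow x (suc k) = x * pow x k

  trUpTo : ℕ → Carrier → Carrier
  trUpTo zero    x = 0#
  trUpTo (suc k) x = trUpTo k x + pow x (2 Nat.^ k)

  Tr : Carrier → Carrier
  Tr = trUpTo n

-- Relative difference sets in an abelian group G (written multiplicatively
-- in the stdlib bundle; difference r - r' is r ∙ r' ⁻¹), relative to N.
module _ (G : AbelianGroup 0ℓ 0ℓ) where
  open AbelianGroup G

  DiffPairs : (Carrier → Set) → Carrier → Set
  DiffPairs R g = Σ (Carrier × Carrier) λ { (r , r') →
    R r × R r' × ¬ (r ≈ r') × ((r ∙ (r' ⁻¹)) ≈ g) }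

  IsRelDiffSet : (m' n' k' lam : ℕ) → (N : Carrier → Set) → (R : Carrier → Set) → Set
  IsRelDiffSet m' n' k' lam N R =
      HasSize Carrier _≈_ (m' Nat.* n')
    × N ε
    × (∀ x y → N x → N y → N (x ∙ y))
    × (∀ x → N x → N (x ⁻¹))
    × (∀ x y → x ≈ y → N x → N y)
    × HasSize (Σ Carrier N) (λ a b → proj₁ a ≈ proj₁ b) n'
    × (∀ x y → x ≈ y → R x → R y)
    × HasSize (Σ Carrier R) (λ a b → proj₁ a ≈ proj₁ b) k'
    × (∀ g → ¬ N g → HasSize (DiffPairs R g) (λ a b → (proj₁ (proj₁ a) ≈ proj₁ (proj₁ b)) × (proj₂ (proj₁ a) ≈ proj₂ (proj₁ b))) lam)
    × (∀ g → N g → ¬ (g ≈ ε) → ¬ DiffPairs R g)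

module Submission where

open import Defs
open import Data.Nat using (ℕ; _≥_; _∸_)
import Data.Nat as Nat
open import Data.Product using (∃; _×_)
open import Data.Sum using (_⊎_)
open import Relation.Nullary using (¬_)
open import Level using (0ℓ)
open import Data.Nat using (zero; suc)
import Data.Nat.Properties as ℕₚ
open import Data.Fin as Fin using (Fin)
open import Data.Product using (Σ; _,_; proj₁; proj₂)
open import Data.Sum as Sum using (inj₁; inj₂)
open import Data.Sum.Relation.Binary.Pointwise using (Pointwise; inj₁; inj₂)
open import Function using (_∘_; _on_)
open import Relation.Nullary using (yes; no; contradiction)
open import Relation.Binary using (Rel; Transitive)
open import Relation.Binary.PropositionalEquality as ≡ using (_≡_; _≢_)
import Relation.Binary.Construct.On as On

-- Substituting u = x³, which is a bijection because the degree 2m + 1 is odd, turns K into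
-- K₀ u = L u + γ T u with L u = u² + α u additive with kernel {0, α} and T u = Tr (α⁻³ u³ + β u).
-- Since Tr (β α) = 1 = Tr 1, T is invariant under u ↦ u + α, so the image of K is the injective
-- image under K₀ of a transversal S of this translation and has 2^2m elements.  As γ ∉ im L, every
-- g is L w + γ b with b ∈ {0, 1}, and K₀ u + K₀ v = g forces v ∈ {u + w, u + w + α} and
-- T u + T (u + w) = b.  For w ∉ {0, α} the left-hand side is Tr (ℓ w · u) + T w with ℓ w ≠ 0, which
-- equals b for exactly half of all u and, being α-periodic, for half of those in S: 2^(2m-1) pairs.
-- For g = γ one would need T u + T u = 1.  Characteristic 2 and x^(2^n) = x are derived from the
-- field having 2^n elements.

module HasSize-Properties where
  open import Data.Nat using (_+_; _*_; _<_; _<?_)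
  open import Data.Fin using (zero; suc; toℕ; punchIn; punchOut; splitAt; join)
  import Data.Fin.Properties as Finₚ
  open import Data.Sum using ([_,_]′)
  open import Function.Definitions using (Injective)
  open import Relation.Unary using (Pred; Decidable)
  open import Relation.Binary using (IsEquivalence; _Respects_) renaming (Decidable to Decidable₂)
  open import Relation.Binary.PropositionalEquality
    using (refl; sym; trans; cong; subst; subst₂; module ≡-Reasoning)

  private
    variable
      A B : Set
      _≈_ : Rel A 0ℓ
      _∼_ : Rel B 0ℓ
      k k′ s : ℕ

  module Enumeration {A : Set} {_≈_ : Rel A 0ℓ} (≈-equiv : IsEquivalence _≈_)
                     {k : ℕ} (size : HasSize A _≈_ k) where
    private module ≈ = IsEquivalence ≈-equiv

    enum : Fin k → A
    enum = proj₁ size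

    enum-injective : ∀ i j → enum i ≈ enum j → i ≡ j
    enum-injective = proj₁ (proj₂ size)

    index : A → Fin k
    index a = proj₁ (proj₂ (proj₂ size) a)

    enum-index : ∀ a → enum (index a) ≈ a
    enum-index a = proj₂ (proj₂ (proj₂ size) a)

    index-cong : ∀ {a b} → a ≈ b → index a ≡ index b
    index-cong {a} {b} a≈b = enum-injective _ _ (≈.trans (enum-index a) (≈.trans a≈b (≈.sym (enum-index b))))

    index-injective : ∀ {a b} → index a ≡ index b → a ≈ b
    index-injective {a} {b} eq = ≈.trans (≈.sym (enum-index a)) (subst (λ i → enum i ≈ b) (sym eq) (enum-index b))

    index-enum : ∀ i → index (enum i) ≡ i
    index-enum i = enum-injective _ _ (enum-index (enum i))

    _≟_ : Decidable₂ _≈_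
    a ≟ b with index a Fin.≟ index b
    ... | yes eq = yes (index-injective eq)
    ... | no neq = no (neq ∘ index-cong)

  HasSize-bijection : Transitive _∼_ →
    HasSize A _≈_ k → (h : A → B) → (∀ {a a′} → a ≈ a′ → h a ∼ h a′) →
    (∀ {a a′} → h a ∼ h a′ → a ≈ a′) → (∀ b → ∃ λ a → h a ∼ b) → HasSize B _∼_ k
  HasSize-bijection {_∼_ = _∼_} ∼-trans (enum , enum-injective , enum-onto) h h-cong h-injective h-onto =
    h ∘ enum , (λ i j → enum-injective i j ∘ h-injective) , onto
    where
    onto : ∀ b → ∃ λ i → h (enum i) ∼ b
    onto b with h-onto b
    ... | a , ha∼b with enum-onto a
    ...   | i , enum-i≈a = i , ∼-trans (h-cong enum-i≈a) ha∼b

  HasSize-unique : IsEquivalence _≈_ →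
    HasSize A _≈_ k → HasSize A _≈_ k′ → k ≡ k′
  HasSize-unique {_≈_ = _≈_} ≈-equiv size size′ =
    Finₚ.cantor-schröder-bernstein (embedding size size′) (embedding size′ size)
    where
    open Enumeration ≈-equiv
    embedding : ∀ {k k′} (size : HasSize _ _≈_ k) (size′ : HasSize _ _≈_ k′) →
      Injective _≡_ _≡_ (index size′ ∘ enum size)
    embedding size size′ = enum-injective size _ _ ∘ index-injective size′

  HasSize-⊎ : HasSize A _≈_ k → HasSize B _∼_ k′ → HasSize (A ⊎ B) (Pointwise _≈_ _∼_) (k + k′)
  HasSize-⊎ {A = A} {_≈_ = _≈_} {k = k} {B = B} {_∼_ = _∼_} {k′ = k′}
    (enumA , injectiveA , ontoA) (enumB , injectiveB , ontoB) =
    enum ∘ splitAt k , injective , onto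
    where
    enum : Fin k ⊎ Fin k′ → A ⊎ B
    enum = [ inj₁ ∘ enumA , inj₂ ∘ enumB ]′

    enum-injective : ∀ x y → Pointwise _≈_ _∼_ (enum x) (enum y) → x ≡ y
    enum-injective (inj₁ i) (inj₁ j) (inj₁ e) = cong inj₁ (injectiveA i j e)
    enum-injective (inj₂ i) (inj₂ j) (inj₂ e) = cong inj₂ (injectiveB i j e)

    injective : ∀ i j → Pointwise _≈_ _∼_ (enum (splitAt k i)) (enum (splitAt k j)) → i ≡ j
    injective i j e = begin
      i                        ≡⟨ Finₚ.join-splitAt k k′ i ⟨
      join k k′ (splitAt k i)  ≡⟨ cong (join k k′) (enum-injective (splitAt k i) (splitAt k j) e) ⟩
      join k k′ (splitAt k j)  ≡⟨ Finₚ.join-splitAt k k′ j ⟩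
      j                        ∎
      where open ≡-Reasoning

    onto-Fin : ∀ z → ∃ λ x → Pointwise _≈_ _∼_ (enum x) z
    onto-Fin (inj₁ a) = inj₁ (proj₁ (ontoA a)) , inj₁ (proj₂ (ontoA a))
    onto-Fin (inj₂ b) = inj₂ (proj₁ (ontoB b)) , inj₂ (proj₂ (ontoB b))

    onto : ∀ z → ∃ λ i → Pointwise _≈_ _∼_ (enum (splitAt k i)) z
    onto z with onto-Fin z
    ... | x , e = join k k′ x , subst (λ y → Pointwise _≈_ _∼_ (enum y) z) (sym (Finₚ.splitAt-join k k′ x)) e

  HasSize-Fin-subset : (Q : Pred (Fin k) 0ℓ) → Decidable Q →
    ∃ λ s → HasSize (Σ (Fin k) Q) (_≡_ on proj₁) s
  HasSize-Fin-subset {zero} Q Q? = 0 , (λ ()) , (λ ()) , λ ()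
  HasSize-Fin-subset {suc k} Q Q? with HasSize-Fin-subset (Q ∘ suc) (Q? ∘ suc) | Q? zero
  ... | s , enum , injective , onto | yes q₀ = suc s , enum′ , injective′ , onto′
    where
    enum′ : Fin (suc s) → Σ (Fin (suc k)) Q
    enum′ zero    = zero , q₀
    enum′ (suc i) = suc (proj₁ (enum i)) , proj₂ (enum i)

    injective′ : ∀ i j → proj₁ (enum′ i) ≡ proj₁ (enum′ j) → i ≡ j
    injective′ zero    zero    _ = refl
    injective′ (suc i) (suc j) e = cong suc (injective i j (Finₚ.suc-injective e))

    onto′ : ∀ a → ∃ λ i → proj₁ (enum′ i) ≡ proj₁ a
    onto′ (zero , _)  = zero , refl
    onto′ (suc a , q) = suc (proj₁ (onto (a , q))) , cong suc (proj₂ (onto (a , q)))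
  ... | s , enum , injective , onto | no ¬q₀ = s , enum′ , injective′ , onto′
    where
    enum′ : Fin s → Σ (Fin (suc k)) Q
    enum′ i = suc (proj₁ (enum i)) , proj₂ (enum i)

    injective′ : ∀ i j → proj₁ (enum′ i) ≡ proj₁ (enum′ j) → i ≡ j
    injective′ i j e = injective i j (Finₚ.suc-injective e)

    onto′ : ∀ a → ∃ λ i → proj₁ (enum′ i) ≡ proj₁ a
    onto′ (zero , q)  = contradiction q ¬q₀
    onto′ (suc a , q) = proj₁ (onto (a , q)) , cong suc (proj₂ (onto (a , q)))

  HasSize-subset : IsEquivalence _≈_ → HasSize A _≈_ k → (P : Pred A 0ℓ) → Decidable P → P Respects _≈_ →
    ∃ λ s → HasSize (Σ A P) (_≈_ on proj₁) s
  HasSize-subset {A = A} {_≈_ = _≈_} {k = k} ≈-equiv size P P? P-resp =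
    proj₁ subsetQ , HasSize-bijection {_∼_ = _≈_ on proj₁} ≈.trans (proj₂ subsetQ) h
      (λ {x} {y} → h-cong {x} {y}) (λ {x} {y} → h-injective {x} {y}) h-onto
    where
    module ≈ = IsEquivalence ≈-equiv
    open Enumeration ≈-equiv size
    Q : Pred (Fin k) 0ℓ
    Q = P ∘ enum
    subsetQ : ∃ λ s → HasSize (Σ (Fin k) Q) (_≡_ on proj₁) s
    subsetQ = HasSize-Fin-subset Q (P? ∘ enum)
    h : Σ (Fin k) Q → Σ A P
    h (i , p) = enum i , p
    h-cong : {x y : Σ (Fin k) Q} → proj₁ x ≡ proj₁ y → proj₁ (h x) ≈ proj₁ (h y)
    h-cong refl = ≈.refl
    h-injective : {x y : Σ (Fin k) Q} → proj₁ (h x) ≈ proj₁ (h y) → proj₁ x ≡ proj₁ y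
    h-injective = enum-injective _ _
    h-onto : ∀ b → ∃ λ a → proj₁ (h a) ≈ proj₁ b
    h-onto (a , p) = (index a , P-resp (≈.sym (enum-index a)) p) , enum-index a

  HasSize-remove : IsEquivalence _≈_ → HasSize A _≈_ (suc k) → (a : A) →
    HasSize (Σ A λ x → ¬ x ≈ a) (_≈_ on proj₁) k
  HasSize-remove {_≈_ = _≈_} ≈-equiv size a = enum′ , injective′ , onto′
    where
    open Enumeration ≈-equiv size
    enum′ : Fin _ → Σ _ λ x → ¬ x ≈ a
    enum′ j = enum (punchIn (index a) j) ,
              λ e → Finₚ.punchInᵢ≢i (index a) j (trans (sym (index-enum _)) (index-cong e))
    injective′ : ∀ i j → proj₁ (enum′ i) ≈ proj₁ (enum′ j) → i ≡ j
    injective′ i j e = Finₚ.punchIn-injective (index a) i j (enum-injective _ _ e)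
    onto′ : ∀ x → ∃ λ j → proj₁ (enum′ j) ≈ proj₁ x
    onto′ (x , x≉a) = punchOut index-a≢index-x ,
      subst (λ i → enum i ≈ x) (sym (Finₚ.punchIn-punchOut index-a≢index-x)) (enum-index x)
      where
      index-a≢index-x : index a ≢ index x
      index-a≢index-x e = x≉a (index-injective (sym e))

  record FreeInvolution {A : Set} (_≈_ : Rel A 0ℓ) : Set where
    field
      σ                : A → A
      σ-cong           : ∀ {a b} → a ≈ b → σ a ≈ σ b
      σ-involutive     : ∀ a → σ (σ a) ≈ a
      σ-fixedPointFree : ∀ a → ¬ σ a ≈ a

  record Transversal {A : Set} {_≈_ : Rel A 0ℓ} (ι : FreeInvolution _≈_) : Set₁ where
    open FreeInvolution ι
    field
      member      : Pred A 0ℓ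
      member?     : Decidable member
      member-resp : member Respects _≈_
      exclusive   : ∀ a → member a → ¬ member (σ a)
      exhaustive  : ∀ a → ¬ member a → member (σ a)

    Members : Set
    Members = Σ A member

  transversal-exists : IsEquivalence _≈_ → HasSize A _≈_ k → (ι : FreeInvolution _≈_) → Transversal ι
  transversal-exists {A = A} {_≈_ = _≈_} ≈-equiv size ι = record
    { member      = below
    ; member?     = λ a → toℕ (index a) <? toℕ (index (σ a))
    ; member-resp = λ a≈b → subst₂ (λ i j → toℕ i < toℕ j) (index-cong a≈b) (index-cong (σ-cong a≈b))
    ; exclusive   = λ a a<σa σa<σσa →
        ℕₚ.<-asym a<σa (subst (below-index (σ a)) (index-cong (σ-involutive a)) σa<σσa)
    ; exhaustive  = exhaustive
    }
    where
    open FreeInvolution ι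
    open Enumeration ≈-equiv size
    below : Pred _ 0ℓ
    below a = toℕ (index a) < toℕ (index (σ a))
    below-index : A → Pred (Fin _) 0ℓ
    below-index a i = toℕ (index a) < toℕ i
    exhaustive : ∀ a → ¬ below a → below (σ a)
    exhaustive a a≮σa = subst (below-index (σ a)) (sym (index-cong (σ-involutive a)))
      (ℕₚ.≤∧≢⇒< (ℕₚ.≮⇒≥ a≮σa) (λ e → σ-fixedPointFree a (index-injective (Finₚ.toℕ-injective e))))

  module _ {A : Set} {_≈_ : Rel A 0ℓ} (≈-equiv : IsEquivalence _≈_) {ι : FreeInvolution _≈_} where
    private module ≈ = IsEquivalence ≈-equiv
    open FreeInvolution ι

    transversal-size : HasSize A _≈_ k → (T : Transversal ι) →
      ∃ λ s → HasSize (Transversal.Members T) (_≈_ on proj₁) s × k ≡ 2 * s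
    transversal-size {k = k} size T = ∣T∣ , sizeT , k≡2∣T∣
      where
      open Transversal T
      subset : ∃ λ s → HasSize Members (_≈_ on proj₁) s
      subset = HasSize-subset ≈-equiv size member member? member-resp
      ∣T∣ : ℕ
      ∣T∣ = proj₁ subset
      sizeT : HasSize Members (_≈_ on proj₁) ∣T∣
      sizeT = proj₂ subset
      _≈ₘ_ : Rel Members 0ℓ
      _≈ₘ_ = _≈_ on proj₁
      h : Members ⊎ Members → A
      h (inj₁ (a , _)) = a
      h (inj₂ (a , _)) = σ a
      h-cong : ∀ {x y} → Pointwise _≈ₘ_ _≈ₘ_ x y → h x ≈ h y
      h-cong (inj₁ a≈b) = a≈b
      h-cong (inj₂ a≈b) = σ-cong a≈b
      h-injective : ∀ {x y} → h x ≈ h y → Pointwise _≈ₘ_ _≈ₘ_ x y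
      h-injective {inj₁ _}       {inj₁ _}       a≈b  = inj₁ a≈b
      h-injective {inj₁ (a , p)} {inj₂ (b , q)} a≈σb =
        contradiction (member-resp a≈σb p) (exclusive b q)
      h-injective {inj₂ (a , p)} {inj₁ (b , q)} σa≈b =
        contradiction (member-resp (≈.sym σa≈b) q) (exclusive a p)
      h-injective {inj₂ (a , _)} {inj₂ (b , _)} σa≈σb =
        inj₂ (≈.trans (≈.sym (σ-involutive a)) (≈.trans (σ-cong σa≈σb) (σ-involutive b)))
      h-onto : ∀ a → ∃ λ x → h x ≈ a
      h-onto a with member? a
      ... | yes p = inj₁ (a , p) , ≈.refl
      ... | no ¬p = inj₂ (σ a , exhaustive a ¬p) , σ-involutive a
      k≡2∣T∣ : k ≡ 2 * ∣T∣
      k≡2∣T∣ = begin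
        k            ≡⟨ HasSize-unique ≈-equiv size
                          (HasSize-bijection ≈.trans (HasSize-⊎ sizeT sizeT) h
                            (λ {x} {y} → h-cong {x} {y}) (λ {x} {y} → h-injective {x} {y}) h-onto) ⟩
        ∣T∣ + ∣T∣  ≡⟨ cong (∣T∣ +_) (ℕₚ.+-identityʳ ∣T∣) ⟨
        2 * ∣T∣    ∎
        where open ≡-Reasoning

    HasSize-transversal : HasSize A _≈_ (2 * s) → (T : Transversal ι) →
      HasSize (Transversal.Members T) (_≈_ on proj₁) s
    HasSize-transversal {s = s} size T with transversal-size size T
    ... | s′ , sizeT , 2s≡2s′ rewrite ℕₚ.*-cancelˡ-≡ s s′ 2 2s≡2s′ = sizeT

    representative : (T : Transversal ι) → ∀ a → ∃ λ c → Transversal.member T c × (c ≈ a ⊎ c ≈ σ a)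
    representative T a with Transversal.member? T a
    ... | yes p = a , p , inj₁ ≈.refl
    ... | no ¬p = σ a , Transversal.exhaustive T a ¬p , inj₂ ≈.refl

    member-unique : (T : Transversal ι) → ∀ {a b} → Transversal.member T a → Transversal.member T b →
      b ≈ a ⊎ b ≈ σ a → a ≈ b
    member-unique T pa pb (inj₁ b≈a)  = ≈.sym b≈a
    member-unique T {a} pa pb (inj₂ b≈σa) =
      contradiction (Transversal.member-resp T b≈σa pb) (Transversal.exclusive T a pa)

    FreeInvolution-even : HasSize A _≈_ k → ∃ λ s → k ≡ 2 * s
    FreeInvolution-even size =
      let s , _ , k≡2s = transversal-size size (transversal-exists ≈-equiv size ι) in s , k≡2s

  module _ {A : Set} {_≈_ : Rel A 0ℓ} (ι : FreeInvolution _≈_) (P : Pred A 0ℓ) where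
    open FreeInvolution ι

    restrict : (∀ {a} → P a → P (σ a)) → FreeInvolution {Σ A P} (_≈_ on proj₁)
    restrict P-σ = record
      { σ                = λ (a , p) → σ a , P-σ p
      ; σ-cong           = σ-cong
      ; σ-involutive     = σ-involutive ∘ proj₁
      ; σ-fixedPointFree = σ-fixedPointFree ∘ proj₁
      }

    Transversal-restrict : (P-σ : ∀ {a} → P a → P (σ a)) → Transversal ι → Transversal (restrict P-σ)
    Transversal-restrict P-σ T = record
      { member      = member ∘ proj₁
      ; member?     = member? ∘ proj₁
      ; member-resp = member-resp
      ; exclusive   = exclusive ∘ proj₁
      ; exhaustive  = exhaustive ∘ proj₁
      }
      where open Transversal T

  Fin-injective⇒surjective : (f : Fin k → Fin k) → Injective _≡_ _≡_ f → ∀ j → ∃ λ i → f i ≡ j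
  Fin-injective⇒surjective {suc k} f f-injective j with Finₚ.any? (λ i → f i Fin.≟ j)
  ... | yes hit  = hit
  ... | no  miss = contradiction (Finₚ.injective⇒≤ g-injective) ℕₚ.1+n≰n
    where
    j≢f : ∀ i → j ≢ f i
    j≢f i j≡fi = miss (i , sym j≡fi)
    g : Fin (suc k) → Fin k
    g i = punchOut (j≢f i)
    g-injective : Injective _≡_ _≡_ g
    g-injective {i} {i′} = f-injective ∘ Finₚ.punchOut-injective (j≢f i) (j≢f i′)

  HasSize-injective⇒surjective : IsEquivalence _∼_ → HasSize A _≈_ k → HasSize B _∼_ k → (h : A → B) →
    (∀ {a a′} → h a ∼ h a′ → a ≈ a′) → ∀ b → ∃ λ a → h a ∼ b
  HasSize-injective⇒surjective ∼-equiv (enumA , injectiveA , _) sizeB h h-injective b =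
    let i , hit = Fin-injective⇒surjective (index ∘ h ∘ enumA)
                    (λ {i} {j} → injectiveA i j ∘ h-injective ∘ index-injective) (index b)
    in enumA i , index-injective hit
    where open Enumeration ∼-equiv sizeB

open HasSize-Properties

module Field2^-Properties {n : ℕ} (F : Field2^ n) where
  open Field2^ F
  import Data.Fin.Permutation as Perm
  open import Algebra.Properties.CommutativeSemiring.Exp commutativeSemiring
    using (_^_; ^-congˡ; ^-homo-*; ^-assocʳ; ^-distrib-*)
  open import Algebra.Properties.CommutativeMonoid.Sum *-commutativeMonoid
    using (∑-permute; sum-cong-≋) renaming (sum to product)
  open import Algebra.Properties.Group +-group
    using (⁻¹-involutive; inverseˡ-unique; ∙-cancelʳ; ε⁻¹≈ε)
    renaming (⁻¹-injective to -‿injective)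
  open import Algebra.Properties.CommutativeSemigroup +-commutativeSemigroup public
    using () renaming (interchange to +-interchange; xy∙z≈xz∙y to [x+y]+z≈[x+z]+y)
  open import Algebra.Properties.CommutativeSemigroup *-commutativeSemigroup public
    using () renaming (interchange to *-interchange; x∙yz≈y∙xz to x*[y*z]≈y*[x*z])
  open import Algebra.Solver.Ring.NaturalCoefficients.Default commutativeSemiring
  open import Relation.Binary.Reasoning.Setoid setoid
  open Enumeration isEquivalence size public using (_≟_)

  private
    variable
      x y z a b : Carrier
      j k : ℕ

  inverseˡ : ¬ x ≈ 0# → x ⁻¹ * x ≈ 1#
  inverseˡ {x} x≉0 = trans (*-comm (x ⁻¹) x) (inverseʳ x x≉0)

  *-cancelˡ : ¬ x ≈ 0# → x * a ≈ x * b → a ≈ b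
  *-cancelˡ {x} {a} {b} x≉0 xa≈xb = begin
    a               ≈⟨ *-identityˡ a ⟨
    1# * a          ≈⟨ *-congʳ (inverseˡ x≉0) ⟨
    (x ⁻¹ * x) * a  ≈⟨ *-assoc _ _ _ ⟩
    x ⁻¹ * (x * a)  ≈⟨ *-congˡ xa≈xb ⟩
    x ⁻¹ * (x * b)  ≈⟨ *-assoc _ _ _ ⟨
    (x ⁻¹ * x) * b  ≈⟨ *-congʳ (inverseˡ x≉0) ⟩
    1# * b          ≈⟨ *-identityˡ b ⟩
    b               ∎

  *-cancelʳ : ¬ x ≈ 0# → a * x ≈ b * x → a ≈ b
  *-cancelʳ {x} {a} {b} x≉0 ax≈bx = *-cancelˡ x≉0 (trans (*-comm x a) (trans ax≈bx (*-comm b x)))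

  *-zero-divisor : ¬ x ≈ 0# → x * y ≈ 0# → y ≈ 0#
  *-zero-divisor {x} x≉0 xy≈0 = *-cancelˡ x≉0 (trans xy≈0 (sym (zeroʳ x)))

  *-nonzero : ¬ x ≈ 0# → ¬ y ≈ 0# → ¬ x * y ≈ 0#
  *-nonzero x≉0 y≉0 = y≉0 ∘ *-zero-divisor x≉0

  ⁻¹-nonzero : ¬ x ≈ 0# → ¬ x ⁻¹ ≈ 0#
  ⁻¹-nonzero {x} x≉0 x⁻¹≈0 = 1≉0 (trans (sym (inverseʳ x x≉0)) (trans (*-congˡ x⁻¹≈0) (zeroʳ x)))

  pow≡^ : ∀ x k → pow x k ≡ x ^ k
  pow≡^ x zero    = ≡.refl
  pow≡^ x (suc k) = ≡.cong (x *_) (pow≡^ x k)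

  pow-cong : ∀ k → x ≈ y → pow x k ≈ pow y k
  pow-cong {x} {y} k x≈y rewrite pow≡^ x k | pow≡^ y k = ^-congˡ k x≈y

  pow-+ : ∀ x j k → pow x (j Nat.+ k) ≈ pow x j * pow x k
  pow-+ x j k rewrite pow≡^ x (j Nat.+ k) | pow≡^ x j | pow≡^ x k = ^-homo-* x j k

  pow-* : ∀ x j k → pow x (j Nat.* k) ≈ pow (pow x j) k
  pow-* x j k rewrite pow≡^ x (j Nat.* k) | pow≡^ x j | pow≡^ (x ^ j) k = sym (^-assocʳ x j k)

  pow-distrib-* : ∀ x y k → pow (x * y) k ≈ pow x k * pow y k
  pow-distrib-* x y k rewrite pow≡^ (x * y) k | pow≡^ x k | pow≡^ y k = ^-distrib-* x y k

  pow-1# : ∀ k → pow 1# k ≈ 1#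
  pow-1# zero    = refl
  pow-1# (suc k) = trans (*-identityˡ _) (pow-1# k)

  pow-nonzero : ∀ k → ¬ x ≈ 0# → ¬ pow x k ≈ 0#
  pow-nonzero zero    x≉0 = 1≉0
  pow-nonzero (suc k) x≉0 = *-nonzero x≉0 (pow-nonzero k x≉0)

  pow-2 : ∀ x → pow x 2 ≈ x * x
  pow-2 x = *-congˡ (*-identityʳ x)

  pow-3 : ∀ x → pow x 3 ≈ x * (x * x)
  pow-3 x = *-congˡ (pow-2 x)

  square≈0⇒≈0 : pow x 2 ≈ 0# → x ≈ 0#
  square≈0⇒≈0 {x} x²≈0 with x ≟ 0#
  ... | yes x≈0 = x≈0
  ... | no  x≉0 = *-zero-divisor x≉0 (trans (sym (pow-2 x)) x²≈0)

  product-nonzero : ∀ {k} (f : Fin k → Carrier) → (∀ i → ¬ f i ≈ 0#) → ¬ product f ≈ 0#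
  product-nonzero {zero}  f f≉0 = 1≉0
  product-nonzero {suc k} f f≉0 = *-nonzero (f≉0 Fin.zero) (product-nonzero (f ∘ Fin.suc) (f≉0 ∘ Fin.suc))

  product-scale : ∀ {k} c (f : Fin k → Carrier) → product (λ i → c * f i) ≈ pow c k * product f
  product-scale {zero}  c f = sym (*-identityˡ 1#)
  product-scale {suc k} c f = begin
    (c * f Fin.zero) * product (λ i → c * f (Fin.suc i))  ≈⟨ *-congˡ (product-scale c (f ∘ Fin.suc)) ⟩
    (c * f Fin.zero) * (pow c k * product (f ∘ Fin.suc))  ≈⟨ *-interchange c (f Fin.zero) (pow c k) _ ⟩
    (c * pow c k) * (f Fin.zero * product (f ∘ Fin.suc))  ∎

  Unit : Set
  Unit = Σ Carrier λ x → ¬ x ≈ 0#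

  units : ℕ
  units = Nat.pred (2 Nat.^ n)

  2^n≡1+units : 2 Nat.^ n ≡ suc units
  2^n≡1+units = ≡.sym (ℕₚ.suc-pred (2 Nat.^ n) {{ℕₚ.m^n≢0 2 n}})

  HasSize-units : HasSize Unit (_≈_ on proj₁) units
  HasSize-units = HasSize-remove isEquivalence (≡.subst (HasSize Carrier _≈_) 2^n≡1+units size) 0#

  -- Multiplication by a unit permutes the units, so it fixes their product P: a ^ units * P ≈ P.
  pow-units : ¬ a ≈ 0# → pow a units ≈ 1#
  pow-units {a} a≉0 = sym (*-cancelʳ P≉0 (begin
    1# * P                       ≈⟨ *-identityˡ P ⟩
    P                            ≈⟨ ∑-permute unit π ⟩
    product (unit ∘ scaleᶠ a≉0)  ≈⟨ sum-cong-≋ (enum-index ∘ scaleᵘ a≉0 ∘ enum) ⟩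
    product (λ i → a * unit i)   ≈⟨ product-scale a unit ⟩
    pow a units * P              ∎))
    where
    open Enumeration (On.isEquivalence proj₁ isEquivalence) HasSize-units
    unit : Fin units → Carrier
    unit = proj₁ ∘ enum
    P : Carrier
    P = product unit
    P≉0 : ¬ P ≈ 0#
    P≉0 = product-nonzero unit (proj₂ ∘ enum)
    scaleᵘ : ∀ {c} → ¬ c ≈ 0# → Unit → Unit
    scaleᵘ {c} c≉0 (x , x≉0) = c * x , *-nonzero c≉0 x≉0
    scaleᶠ : ∀ {c} → ¬ c ≈ 0# → Fin units → Fin units
    scaleᶠ c≉0 = index ∘ scaleᵘ c≉0 ∘ enum
    cancels : ∀ {c d} (c≉0 : ¬ c ≈ 0#) (d≉0 : ¬ d ≈ 0#) → c * d ≈ 1# →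
      ∀ i → scaleᶠ c≉0 (scaleᶠ d≉0 i) ≡ i
    cancels {c} {d} c≉0 d≉0 cd≈1 i = ≡.trans (index-cong {scaleᵘ c≉0 (enum (scaleᶠ d≉0 i))} {enum i} (begin
      c * unit (scaleᶠ d≉0 i)  ≈⟨ *-congˡ (enum-index (scaleᵘ d≉0 (enum i))) ⟩
      c * (d * unit i)         ≈⟨ *-assoc c d _ ⟨
      (c * d) * unit i         ≈⟨ *-congʳ cd≈1 ⟩
      1# * unit i              ≈⟨ *-identityˡ _ ⟩
      unit i                   ∎)) (index-enum i)
    π : Perm.Permutation units units
    π = Perm.permutation (scaleᶠ a≉0) (scaleᶠ (⁻¹-nonzero a≉0))
          (cancels a≉0 (⁻¹-nonzero a≉0) (inverseʳ a a≉0)) (cancels (⁻¹-nonzero a≉0) a≉0 (inverseˡ a≉0))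

  fermat : ∀ x → pow x (2 Nat.^ n) ≈ x
  fermat x rewrite 2^n≡1+units with x ≟ 0#
  ... | yes x≈0 = trans (*-congʳ x≈0) (trans (zeroˡ _) (sym x≈0))
  ... | no  x≉0 = trans (*-congˡ (pow-units x≉0)) (*-identityʳ x)

  pow-units+2^n : ∀ y → pow y (units Nat.+ 2 Nat.^ n) ≈ y
  pow-units+2^n y = begin
    pow y (units Nat.+ 2 Nat.^ n)    ≈⟨ pow-+ y units (2 Nat.^ n) ⟩
    pow y units * pow y (2 Nat.^ n)  ≈⟨ *-congˡ (fermat y) ⟩
    pow y units * y                  ≈⟨ *-comm _ y ⟩
    pow y (suc units)                ≡⟨ ≡.cong (pow y) 2^n≡1+units ⟨
    pow y (2 Nat.^ n)                ≈⟨ fermat y ⟩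
    y                                ∎

  degree-nonzero : n ≢ 0
  degree-nonzero ≡.refl = 1≉0 (index-injective (single (index 1#) (index 0#)))
    where
    open Enumeration isEquivalence size using (index; index-injective)
    single : (i j : Fin 1) → i ≡ j
    single Fin.zero Fin.zero = ≡.refl

  2^n≡2*2^[n-1] : 2 Nat.^ n ≡ 2 Nat.* 2 Nat.^ (n Nat.∸ 1)
  2^n≡2*2^[n-1] = lemma degree-nonzero
    where
    lemma : ∀ {k} → k ≢ 0 → 2 Nat.^ k ≡ 2 Nat.* 2 Nat.^ (k Nat.∸ 1)
    lemma {zero}  k≢0 = contradiction ≡.refl k≢0
    lemma {suc k} _   = ≡.refl

  sqrt : Carrier → Carrier
  sqrt y = pow y (2 Nat.^ (n Nat.∸ 1))

  sqrt-square : ∀ y → pow (sqrt y) 2 ≈ y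
  sqrt-square y = begin
    pow (sqrt y) 2                       ≈⟨ pow-* y (2 Nat.^ (n Nat.∸ 1)) 2 ⟨
    pow y (2 Nat.^ (n Nat.∸ 1) Nat.* 2)  ≡⟨ ≡.cong (pow y) (ℕₚ.*-comm (2 Nat.^ (n Nat.∸ 1)) 2) ⟩
    pow y (2 Nat.* 2 Nat.^ (n Nat.∸ 1))  ≡⟨ ≡.cong (pow y) 2^n≡2*2^[n-1] ⟨
    pow y (2 Nat.^ n)                    ≈⟨ fermat y ⟩
    y                                    ∎

  -- Otherwise negation would be a fixed-point-free involution of the odd number 2 ^ n - 1 of units.
  1#+1#≈0# : 1# + 1# ≈ 0#
  1#+1#≈0# with (1# + 1#) ≟ 0#
  ... | yes 2≈0 = 2≈0
  ... | no  2≉0 = contradiction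
    (≡.trans (≡.sym 2^n≡2*2^[n-1]) (≡.trans 2^n≡1+units (≡.cong suc (proj₂ units-even))))
    (ℕₚ.even≢odd (2 Nat.^ (n Nat.∸ 1)) (proj₁ units-even))
    where
    negation : FreeInvolution (_≈_ on proj₁)
    negation = record
      { σ                = λ (x , x≉0) → - x , x≉0 ∘ -‿injective ∘ λ -x≈0 → trans -x≈0 (sym ε⁻¹≈ε)
      ; σ-cong           = -‿cong
      ; σ-involutive     = ⁻¹-involutive ∘ proj₁
      ; σ-fixedPointFree = λ (x , x≉0) -x≈x → x≉0 (*-zero-divisor 2≉0 (begin
          (1# + 1#) * x    ≈⟨ distribʳ x 1# 1# ⟩
          1# * x + 1# * x  ≈⟨ +-cong (*-identityˡ x) (*-identityˡ x) ⟩
          x + x            ≈⟨ +-congˡ -x≈x ⟨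
          x + - x          ≈⟨ -‿inverseʳ x ⟩
          0#               ∎))
      }
    units-even : ∃ λ s → units ≡ 2 Nat.* s
    units-even = FreeInvolution-even (On.isEquivalence proj₁ isEquivalence) {negation} HasSize-units

  x+x≈0 : ∀ x → x + x ≈ 0#
  x+x≈0 x = begin
    x + x            ≈⟨ +-cong (*-identityˡ x) (*-identityˡ x) ⟨
    1# * x + 1# * x  ≈⟨ distribʳ x 1# 1# ⟨
    (1# + 1#) * x    ≈⟨ *-congʳ 1#+1#≈0# ⟩
    0# * x           ≈⟨ zeroˡ x ⟩
    0#               ∎

  -x≈x : ∀ x → - x ≈ x
  -x≈x x = sym (inverseˡ-unique x x (x+x≈0 x))

  x+y≈0⇒x≈y : x + y ≈ 0# → x ≈ y
  x+y≈0⇒x≈y {x} {y} x+y≈0 = trans (inverseˡ-unique x y x+y≈0) (-x≈x y)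

  x+[x+y]≈y : ∀ x y → x + (x + y) ≈ y
  x+[x+y]≈y x y = trans (sym (+-assoc x x y)) (trans (+-congʳ (x+x≈0 x)) (+-identityˡ y))

  x+y≈z⇒y≈x+z : x + y ≈ z → y ≈ x + z
  x+y≈z⇒y≈x+z {x} {y} x+y≈z = trans (sym (x+[x+y]≈y x y)) (+-congˡ x+y≈z)

  x+y≈z+w⇒x+z≈y+w : ∀ {w} → x + y ≈ z + w → x + z ≈ y + w
  x+y≈z+w⇒x+z≈y+w {x} {y} {z} {w} x+y≈z+w = begin
    x + z              ≈⟨ +-congˡ (x+[x+y]≈y y z) ⟨
    x + (y + (y + z))  ≈⟨ +-assoc x y (y + z) ⟨
    (x + y) + (y + z)  ≈⟨ +-congʳ x+y≈z+w ⟩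
    (z + w) + (y + z)  ≈⟨ solve 4 (λ z w y z′ → (z :+ w) :+ (y :+ z′) := (y :+ w) :+ (z :+ z′)) refl z w y z ⟩
    (y + w) + (z + z)  ≈⟨ +-congˡ (x+x≈0 z) ⟩
    (y + w) + 0#       ≈⟨ +-identityʳ _ ⟩
    y + w              ∎

  +-cancelʳ : a + x ≈ b + x → a ≈ b
  +-cancelʳ {a} {x} {b} = ∙-cancelʳ x a b

  x+1#≉x : ∀ x → ¬ x + 1# ≈ x
  x+1#≉x x x+1≈x = 1≉0 (+-cancelʳ (trans (+-comm 1# x) (trans x+1≈x (sym (+-identityˡ x)))))

  translation : ∀ {t} → ¬ t ≈ 0# → FreeInvolution _≈_
  translation {t} t≉0 = record
    { σ                = _+ t
    ; σ-cong           = +-congʳ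
    ; σ-involutive     = λ u → trans (+-assoc u t t) (trans (+-congˡ (x+x≈0 t)) (+-identityʳ u))
    ; σ-fixedPointFree = λ u u+t≈u → t≉0 (trans (sym (x+[x+y]≈y u t)) (trans (+-congˡ u+t≈u) (x+x≈0 u)))
    }

  square-+ : ∀ x y → pow (x + y) 2 ≈ pow x 2 + pow y 2
  square-+ x y = begin
    pow (x + y) 2                      ≈⟨ pow-2 (x + y) ⟩
    (x + y) * (x + y)                  ≈⟨ expand x y ⟩
    (x * x + y * y) + (x * y + x * y)  ≈⟨ +-congˡ (x+x≈0 (x * y)) ⟩
    (x * x + y * y) + 0#               ≈⟨ +-identityʳ _ ⟩
    x * x + y * y                      ≈⟨ +-cong (pow-2 x) (pow-2 y) ⟨
    pow x 2 + pow y 2                  ∎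
    where
    expand : ∀ x y → (x + y) * (x + y) ≈ (x * x + y * y) + (x * y + x * y)
    expand = solve 2 (λ x y → (x :+ y) :* (x :+ y) := (x :* x :+ y :* y) :+ (x :* y :+ x :* y)) refl

  pow-2^suc : ∀ k x → pow x (2 Nat.^ suc k) ≈ pow (pow x 2) (2 Nat.^ k)
  pow-2^suc k x = pow-* x 2 (2 Nat.^ k)

  frobenius-+ : ∀ k x y → pow (x + y) (2 Nat.^ k) ≈ pow x (2 Nat.^ k) + pow y (2 Nat.^ k)
  frobenius-+ zero    x y = trans (*-identityʳ _) (sym (+-cong (*-identityʳ x) (*-identityʳ y)))
  frobenius-+ (suc k) x y = begin
    pow (x + y) (2 Nat.^ suc k)                            ≈⟨ pow-2^suc k (x + y) ⟩
    pow (pow (x + y) 2) (2 Nat.^ k)                        ≈⟨ pow-cong (2 Nat.^ k) (square-+ x y) ⟩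
    pow (pow x 2 + pow y 2) (2 Nat.^ k)                    ≈⟨ frobenius-+ k (pow x 2) (pow y 2) ⟩
    pow (pow x 2) (2 Nat.^ k) + pow (pow y 2) (2 Nat.^ k)  ≈⟨ +-cong (pow-2^suc k x) (pow-2^suc k y) ⟨
    pow x (2 Nat.^ suc k) + pow y (2 Nat.^ suc k)          ∎

  trUpTo-cong : ∀ k → x ≈ y → trUpTo k x ≈ trUpTo k y
  trUpTo-cong zero    x≈y = refl
  trUpTo-cong (suc k) x≈y = +-cong (trUpTo-cong k x≈y) (pow-cong (2 Nat.^ k) x≈y)

  trUpTo-+ : ∀ k x y → trUpTo k (x + y) ≈ trUpTo k x + trUpTo k y
  trUpTo-+ zero    x y = sym (+-identityʳ 0#)
  trUpTo-+ (suc k) x y = trans (+-cong (trUpTo-+ k x y) (frobenius-+ k x y)) (+-interchange _ _ _ _)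

  trUpTo-square : ∀ k x → pow (trUpTo k x) 2 ≈ trUpTo k (pow x 2)
  trUpTo-square zero    x = trans (pow-2 0#) (zeroˡ 0#)
  trUpTo-square (suc k) x = trans (square-+ _ _) (+-cong (trUpTo-square k x) (begin
    pow (pow x (2 Nat.^ k)) 2  ≈⟨ pow-* x (2 Nat.^ k) 2 ⟨
    pow x (2 Nat.^ k Nat.* 2)  ≡⟨ ≡.cong (pow x) (ℕₚ.*-comm (2 Nat.^ k) 2) ⟩
    pow x (2 Nat.^ suc k)      ≈⟨ pow-2^suc k x ⟩
    pow (pow x 2) (2 Nat.^ k)  ∎))

  trUpTo-square-shift : ∀ k x → trUpTo k (pow x 2) + x ≈ trUpTo k x + pow x (2 Nat.^ k)
  trUpTo-square-shift zero    x = +-congˡ (sym (*-identityʳ x))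
  trUpTo-square-shift (suc k) x = begin
    (trUpTo k (pow x 2) + pow (pow x 2) (2 Nat.^ k)) + x      ≈⟨ [x+y]+z≈[x+z]+y _ _ x ⟩
    (trUpTo k (pow x 2) + x) + pow (pow x 2) (2 Nat.^ k)      ≈⟨ +-cong (trUpTo-square-shift k x) (sym (pow-2^suc k x)) ⟩
    (trUpTo k x + pow x (2 Nat.^ k)) + pow x (2 Nat.^ suc k)  ∎

  trUpTo-odd-1# : ∀ j → trUpTo (2 Nat.* j Nat.+ 1) 1# ≈ 1#
  trUpTo-odd-1# zero    = trans (+-identityˡ _) (pow-1# 1)
  trUpTo-odd-1# (suc j) = begin
    trUpTo (2 Nat.* suc j Nat.+ 1) 1#
      ≡⟨ ≡.cong (λ i → trUpTo (i Nat.+ 1) 1#) (ℕₚ.*-suc 2 j) ⟩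
    (trUpTo d 1# + pow 1# (2 Nat.^ d)) + pow 1# (2 Nat.^ suc d)
      ≈⟨ +-assoc _ _ _ ⟩
    trUpTo d 1# + (pow 1# (2 Nat.^ d) + pow 1# (2 Nat.^ suc d))
      ≈⟨ +-congˡ (trans (+-cong (pow-1# (2 Nat.^ d)) (pow-1# (2 Nat.^ suc d))) 1#+1#≈0#) ⟩
    trUpTo d 1# + 0#
      ≈⟨ +-identityʳ _ ⟩
    trUpTo d 1#
      ≈⟨ trUpTo-odd-1# j ⟩
    1#
      ∎
    where
    d : ℕ
    d = 2 Nat.* j Nat.+ 1

  Tr-cong : x ≈ y → Tr x ≈ Tr y
  Tr-cong = trUpTo-cong n

  Tr-+ : ∀ x y → Tr (x + y) ≈ Tr x + Tr y
  Tr-+ = trUpTo-+ n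

  Tr-0# : Tr 0# ≈ 0#
  Tr-0# = trans (Tr-cong (sym (+-identityʳ 0#))) (trans (Tr-+ 0# 0#) (x+x≈0 _))

  Tr-square : ∀ x → Tr (pow x 2) ≈ Tr x
  Tr-square x = +-cancelʳ (trans (trUpTo-square-shift n x) (+-congˡ (fermat x)))

  Tr-*-square : ∀ c u → Tr (c * pow u 2) ≈ Tr (sqrt c * u)
  Tr-*-square c u = begin
    Tr (c * pow u 2)               ≈⟨ Tr-cong (*-congʳ (sqrt-square c)) ⟨
    Tr (pow (sqrt c) 2 * pow u 2)  ≈⟨ Tr-cong (pow-distrib-* (sqrt c) u 2) ⟨
    Tr (pow (sqrt c * u) 2)        ≈⟨ Tr-square (sqrt c * u) ⟩
    Tr (sqrt c * u)                ∎

  IsBit : Carrier → Set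
  IsBit b = b ≈ 0# ⊎ b ≈ 1#

  IsBit-+ : IsBit a → IsBit b → IsBit (a + b)
  IsBit-+ (inj₁ a≈0) (inj₁ b≈0) = inj₁ (trans (+-cong a≈0 b≈0) (+-identityʳ 0#))
  IsBit-+ (inj₁ a≈0) (inj₂ b≈1) = inj₂ (trans (+-cong a≈0 b≈1) (+-identityˡ 1#))
  IsBit-+ (inj₂ a≈1) (inj₁ b≈0) = inj₂ (trans (+-cong a≈1 b≈0) (+-identityʳ 1#))
  IsBit-+ (inj₂ a≈1) (inj₂ b≈1) = inj₁ (trans (+-cong a≈1 b≈1) 1#+1#≈0#)

  IsBit-complement : IsBit a → IsBit b → ¬ a ≈ b → a + 1# ≈ b
  IsBit-complement (inj₁ a≈0) (inj₁ b≈0) a≉b = contradiction (trans a≈0 (sym b≈0)) a≉b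
  IsBit-complement (inj₁ a≈0) (inj₂ b≈1) a≉b = trans (+-congʳ a≈0) (trans (+-identityˡ 1#) (sym b≈1))
  IsBit-complement (inj₂ a≈1) (inj₁ b≈0) a≉b = trans (+-congʳ a≈1) (trans 1#+1#≈0# (sym b≈0))
  IsBit-complement (inj₂ a≈1) (inj₂ b≈1) a≉b = contradiction (trans a≈1 (sym b≈1)) a≉b

  Tr-isBit : ∀ x → IsBit (Tr x)
  Tr-isBit x with Tr x ≟ 0#
  ... | yes t≈0 = inj₁ t≈0
  ... | no  t≉0 = inj₂ (x+y≈0⇒x≈y (*-zero-divisor t≉0 (begin
    t * (t + 1#)    ≈⟨ distribˡ t t 1# ⟩
    t * t + t * 1#  ≈⟨ +-cong (sym (pow-2 t)) (*-identityʳ t) ⟩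
    pow t 2 + t     ≈⟨ +-congʳ (trans (trUpTo-square n x) (Tr-square x)) ⟩
    t + t           ≈⟨ x+x≈0 t ⟩
    0#              ∎)))
    where
    t : Carrier
    t = Tr x

2^[2m+2]≡1+3e : ∀ m → ∃ λ e → suc (3 Nat.* e) ≡ 2 Nat.* 2 Nat.^ (2 Nat.* m Nat.+ 1)
2^[2m+2]≡1+3e zero    = 1 , ≡.refl
2^[2m+2]≡1+3e (suc m) with 2^[2m+2]≡1+3e m
... | e , 1+3e≡2^[2m+2] = 4 Nat.* e Nat.+ 1 , (begin
  suc (3 Nat.* (4 Nat.* e Nat.+ 1))                ≡⟨ solve 1 (λ e → con 1 :+ con 3 :* (con 4 :* e :+ con 1)
                                                                := con 4 :* (con 1 :+ con 3 :* e)) ≡.refl e ⟩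
  4 Nat.* suc (3 Nat.* e)                          ≡⟨ ≡.cong (4 Nat.*_) 1+3e≡2^[2m+2] ⟩
  4 Nat.* (2 Nat.* 2 Nat.^ (2 Nat.* m Nat.+ 1))    ≡⟨ solve 1 (λ x → con 4 :* (con 2 :* x) := con 2 :* (con 2 :* (con 2 :* x)))
                                                        ≡.refl (2 Nat.^ (2 Nat.* m Nat.+ 1)) ⟩
  2 Nat.* 2 Nat.^ (2 Nat.+ 2 Nat.* m Nat.+ 1)      ≡⟨ ≡.cong (λ i → 2 Nat.* 2 Nat.^ (i Nat.+ 1)) (ℕₚ.*-suc 2 m) ⟨
  2 Nat.* 2 Nat.^ (2 Nat.* suc m Nat.+ 1)          ∎)
  where
  open ≡.≡-Reasoning
  open import Data.Nat.Solver using (module +-*-Solver)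
  open +-*-Solver

2^[2m]≡2*2^[2m∸1] : ∀ {m} → m Nat.≥ 1 → 2 Nat.^ (2 Nat.* m) ≡ 2 Nat.* 2 Nat.^ (2 Nat.* m Nat.∸ 1)
2^[2m]≡2*2^[2m∸1] {suc m} _ = ≡.refl

module OddDegree (m : ℕ) (F : Field2^ (2 Nat.* m Nat.+ 1)) where
  open Field2^ F
  open Field2^-Properties F
  open import Relation.Binary.Reasoning.Setoid setoid

  Tr-1# : Tr 1# ≈ 1#
  Tr-1# = trUpTo-odd-1# m

  2^n≡2*2^2m : 2 Nat.^ (2 Nat.* m Nat.+ 1) ≡ 2 Nat.* 2 Nat.^ (2 Nat.* m)
  2^n≡2*2^2m = ≡.cong (2 Nat.^_) (ℕₚ.+-comm (2 Nat.* m) 1)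

  -- 3 divides 2 ^ (2 m + 2) - 1 = units + 2 ^ n, so cubing is invertible.
  cube-exponent : ∃ λ e → 3 Nat.* e ≡ units Nat.+ 2 Nat.^ (2 Nat.* m Nat.+ 1)
  cube-exponent = proj₁ 1+3e≡2q , ℕₚ.suc-injective
    (≡.trans (proj₂ 1+3e≡2q) (≡.trans (≡.cong (q Nat.+_) (ℕₚ.+-identityʳ q)) (≡.cong (Nat._+ q) 2^n≡1+units)))
    where
    q : ℕ
    q = 2 Nat.^ (2 Nat.* m Nat.+ 1)
    1+3e≡2q : ∃ λ e → suc (3 Nat.* e) ≡ 2 Nat.* q
    1+3e≡2q = 2^[2m+2]≡1+3e m

  private
    e : ℕ
    e = proj₁ cube-exponent

    pow-3e : ∀ y → pow y (3 Nat.* e) ≈ y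
    pow-3e y = trans (reflexive (≡.cong (pow y) (proj₂ cube-exponent))) (pow-units+2^n y)

  cbrt : Carrier → Carrier
  cbrt y = pow y e

  cbrt-cube : ∀ y → pow (cbrt y) 3 ≈ y
  cbrt-cube y = trans (sym (pow-* y e 3)) (trans (reflexive (≡.cong (pow y) (ℕₚ.*-comm e 3))) (pow-3e y))

  cube-injective : ∀ {x y} → pow x 3 ≈ pow y 3 → x ≈ y
  cube-injective {x} {y} x³≈y³ = begin
    x                  ≈⟨ pow-3e x ⟨
    pow x (3 Nat.* e)  ≈⟨ pow-* x 3 e ⟩
    pow (pow x 3) e    ≈⟨ pow-cong e x³≈y³ ⟩
    pow (pow y 3) e    ≈⟨ pow-* y 3 e ⟨
    pow y (3 Nat.* e)  ≈⟨ pow-3e y ⟩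
    y                  ∎

module _ (m : ℕ) (F : Field2^ (2 Nat.* m Nat.+ 1)) where
  open Field2^ F
  open Field2^-Properties F
  open OddDegree m F
  open import Algebra.Solver.Ring.NaturalCoefficients.Default commutativeSemiring
  open import Relation.Binary.Reasoning.Setoid setoid

  module Construction (α β γ : Carrier) (α≉0 : ¬ α ≈ 0#) (γ≉0 : ¬ γ ≈ 0#)
      (γ∉L : ∀ x → ¬ (pow x 2 + α * x) ≈ γ) (Tr[βα]≈1 : Tr (β * α) ≈ 1#) where

    α⁻³ : Carrier
    α⁻³ = pow (α ⁻¹) 3

    L : Carrier → Carrier
    L u = pow u 2 + α * u

    cubic : Carrier → Carrier
    cubic u = α⁻³ * pow u 3 + β * u

    T : Carrier → Carrier
    T u = Tr (cubic u)

    K₀ : Carrier → Carrier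
    K₀ u = L u + γ * T u

    K : Carrier → Carrier
    K x = pow x 6 + α * pow x 3 + γ * Tr (pow (α ⁻¹) 3 * pow x 9 + β * pow x 3)

    K≈K₀∘cube : ∀ x → K x ≈ K₀ (pow x 3)
    K≈K₀∘cube x = +-cong (+-congʳ (pow-* x 3 2)) (*-congˡ (Tr-cong (+-congʳ (*-congˡ (pow-* x 3 3)))))

    L-cong : ∀ {u v} → u ≈ v → L u ≈ L v
    L-cong u≈v = +-cong (pow-cong 2 u≈v) (*-congˡ u≈v)

    T-cong : ∀ {u v} → u ≈ v → T u ≈ T v
    T-cong u≈v = Tr-cong (+-cong (*-congˡ (pow-cong 3 u≈v)) (*-congˡ u≈v))

    K₀-cong : ∀ {u v} → u ≈ v → K₀ u ≈ K₀ v
    K₀-cong u≈v = +-cong (L-cong u≈v) (*-congˡ (T-cong u≈v))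

    L-+ : ∀ u v → L (u + v) ≈ L u + L v
    L-+ u v = trans (+-cong (square-+ u v) (distribˡ α u v)) (+-interchange _ _ _ _)

    L-0# : L 0# ≈ 0#
    L-0# = trans (+-cong (trans (pow-2 0#) (zeroˡ 0#)) (zeroʳ α)) (+-identityʳ 0#)

    L-α : L α ≈ 0#
    L-α = trans (+-congʳ (pow-2 α)) (x+x≈0 _)

    L-kernel : ∀ {u} → L u ≈ 0# → u ≈ 0# ⊎ u ≈ α
    L-kernel {u} Lu≈0 with u ≟ 0#
    ... | yes u≈0 = inj₁ u≈0
    ... | no  u≉0 = inj₂ (x+y≈0⇒x≈y (*-zero-divisor u≉0 (begin
      u * (u + α)    ≈⟨ distribˡ u u α ⟩
      u * u + u * α  ≈⟨ +-cong (sym (pow-2 u)) (*-comm u α) ⟩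
      L u            ≈⟨ Lu≈0 ⟩
      0#             ∎)))

    L-fibre : ∀ {u v} → L u ≈ L v → v ≈ u ⊎ v ≈ u + α
    L-fibre {u} {v} Lu≈Lv = Sum.map (λ u+v≈0 → trans (x+y≈z⇒y≈x+z u+v≈0) (+-identityʳ u)) x+y≈z⇒y≈x+z
      (L-kernel (trans (L-+ u v) (trans (+-congˡ (sym Lu≈Lv)) (x+x≈0 _))))

    α⁻³*α³≈1 : α⁻³ * pow α 3 ≈ 1#
    α⁻³*α³≈1 = begin
      pow (α ⁻¹) 3 * pow α 3  ≈⟨ pow-distrib-* (α ⁻¹) α 3 ⟨
      pow (α ⁻¹ * α) 3        ≈⟨ pow-cong 3 (inverseˡ α≉0) ⟩
      pow 1# 3                ≈⟨ pow-1# 3 ⟩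
      1#                      ∎

    -- (u + w)³ + u³ = w u² + w² u + w³ once the doubled terms d + d vanish.
    cubic-+ : ∀ u w → cubic (u + w) + cubic u ≈ ((α⁻³ * w) * pow u 2 + (α⁻³ * pow w 2) * u) + cubic w
    cubic-+ u w = begin
      cubic (u + w) + cubic u
        ≈⟨ +-cong (+-congʳ (*-congˡ (pow-3 (u + w)))) (+-congʳ (*-congˡ (pow-3 u))) ⟩
      (a * ((u + w) * ((u + w) * (u + w))) + β * (u + w)) + (a * (u * (u * u)) + β * u)
        ≈⟨ solve 4 (λ a β u w →
             (a :* ((u :+ w) :* ((u :+ w) :* (u :+ w))) :+ β :* (u :+ w)) :+ (a :* (u :* (u :* u)) :+ β :* u)
             := (((a :* w) :* (u :* u) :+ (a :* (w :* w)) :* u) :+ (a :* (w :* (w :* w)) :+ β :* w)) :+ (D a β u w :+ D a β u w))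
             refl a β u w ⟩
      (((a * w) * (u * u) + (a * (w * w)) * u) + (a * (w * (w * w)) + β * w)) + (d + d)
        ≈⟨ trans (+-congˡ (x+x≈0 d)) (+-identityʳ _) ⟩
      ((a * w) * (u * u) + (a * (w * w)) * u) + (a * (w * (w * w)) + β * w)
        ≈⟨ +-cong (+-cong (*-congˡ (pow-2 u)) (*-congʳ (*-congˡ (pow-2 w)))) (+-congʳ (*-congˡ (pow-3 w))) ⟨
      ((a * w) * pow u 2 + (a * pow w 2) * u) + cubic w
        ∎
      where
      a : Carrier
      a = α⁻³
      D : (a β u w : Polynomial 4) → Polynomial 4
      D = λ a β u w → a :* (u :* (u :* u)) :+ (a :* (u :* u)) :* w :+ ((a :* u) :* (w :* w) :+ β :* u)
      d : Carrier
      d = a * (u * (u * u)) + (a * (u * u)) * w + ((a * u) * (w * w) + β * u)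

    ℓ : Carrier → Carrier
    ℓ w = sqrt (α⁻³ * w) + α⁻³ * pow w 2

    T-derivative : ∀ w u → T u + T (u + w) ≈ Tr (ℓ w * u) + T w
    T-derivative w u = begin
      T u + T (u + w)                                              ≈⟨ +-comm _ _ ⟩
      T (u + w) + T u                                              ≈⟨ Tr-+ _ _ ⟨
      Tr (cubic (u + w) + cubic u)                                 ≈⟨ Tr-cong (cubic-+ u w) ⟩
      Tr (((α⁻³ * w) * pow u 2 + (α⁻³ * pow w 2) * u) + cubic w)   ≈⟨ Tr-+ _ _ ⟩
      Tr ((α⁻³ * w) * pow u 2 + (α⁻³ * pow w 2) * u) + T w         ≈⟨ +-congʳ (Tr-+ _ _) ⟩
      (Tr ((α⁻³ * w) * pow u 2) + Tr ((α⁻³ * pow w 2) * u)) + T w  ≈⟨ +-congʳ (+-congʳ (Tr-*-square _ u)) ⟩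
      (Tr (sqrt (α⁻³ * w) * u) + Tr ((α⁻³ * pow w 2) * u)) + T w   ≈⟨ +-congʳ (Tr-+ _ _) ⟨
      Tr (sqrt (α⁻³ * w) * u + (α⁻³ * pow w 2) * u) + T w          ≈⟨ +-congʳ (Tr-cong (distribʳ u _ _)) ⟨
      Tr (ℓ w * u) + T w                                           ∎

    ℓ-square : ∀ w → pow (ℓ w) 2 ≈ α⁻³ * w + (α⁻³ * w) * (α⁻³ * pow w 3)
    ℓ-square w = trans (square-+ _ _) (+-cong (sqrt-square (α⁻³ * w)) (begin
      pow (α⁻³ * pow w 2) 2            ≈⟨ pow-2 _ ⟩
      (α⁻³ * pow w 2) * (α⁻³ * pow w 2) ≈⟨ *-cong (*-congˡ (pow-2 w)) (*-congˡ (pow-2 w)) ⟩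
      (α⁻³ * (w * w)) * (α⁻³ * (w * w)) ≈⟨ solve 2 (λ a w → (a :* (w :* w)) :* (a :* (w :* w))
                                                         := (a :* w) :* (a :* (w :* (w :* w)))) refl α⁻³ w ⟩
      (α⁻³ * w) * (α⁻³ * (w * (w * w)))  ≈⟨ *-congˡ (*-congˡ (pow-3 w)) ⟨
      (α⁻³ * w) * (α⁻³ * pow w 3)        ∎))

    ℓ-α : ℓ α ≈ 0#
    ℓ-α = square≈0⇒≈0 (begin
      pow (ℓ α) 2                            ≈⟨ ℓ-square α ⟩
      α⁻³ * α + (α⁻³ * α) * (α⁻³ * pow α 3)  ≈⟨ +-congˡ (trans (*-congˡ α⁻³*α³≈1) (*-identityʳ _)) ⟩
      α⁻³ * α + α⁻³ * α                      ≈⟨ x+x≈0 _ ⟩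
      0#                                     ∎)

    -- ℓ w ≈ 0 forces α⁻³ w³ ≈ 1, i.e. w³ ≈ α³, and cubing is injective.
    ℓ-nonzero : ∀ {w} → ¬ w ≈ 0# → ¬ w ≈ α → ¬ ℓ w ≈ 0#
    ℓ-nonzero {w} w≉0 w≉α ℓw≈0 = w≉α (cube-injective (begin
      pow w 3                    ≈⟨ *-identityˡ _ ⟨
      1# * pow w 3               ≈⟨ *-congʳ (trans (*-comm _ _) α⁻³*α³≈1) ⟨
      (pow α 3 * α⁻³) * pow w 3  ≈⟨ *-assoc _ _ _ ⟩
      pow α 3 * (α⁻³ * pow w 3)  ≈⟨ *-congˡ α⁻³w³≈1 ⟨
      pow α 3 * 1#               ≈⟨ *-identityʳ _ ⟩
      pow α 3                    ∎))
      where
      α⁻³w³≈1 : 1# ≈ α⁻³ * pow w 3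
      α⁻³w³≈1 = *-cancelˡ (*-nonzero (pow-nonzero 3 (⁻¹-nonzero α≉0)) w≉0) (trans (*-identityʳ _)
        (x+y≈0⇒x≈y (trans (sym (ℓ-square w)) (trans (pow-cong 2 ℓw≈0) (trans (pow-2 0#) (zeroˡ 0#))))))

    T-α : T α ≈ 0#
    T-α = begin
      Tr (α⁻³ * pow α 3 + β * α)       ≈⟨ Tr-+ _ _ ⟩
      Tr (α⁻³ * pow α 3) + Tr (β * α)  ≈⟨ +-cong (trans (Tr-cong α⁻³*α³≈1) Tr-1#) Tr[βα]≈1 ⟩
      1# + 1#                          ≈⟨ 1#+1#≈0# ⟩
      0#                               ∎

    T-periodic : ∀ u → T (u + α) ≈ T u
    T-periodic u = sym (x+y≈0⇒x≈y (begin
      T u + T (u + α)     ≈⟨ T-derivative α u ⟩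
      Tr (ℓ α * u) + T α  ≈⟨ +-cong (trans (Tr-cong (trans (*-congʳ ℓ-α) (zeroˡ u))) Tr-0#) T-α ⟩
      0# + 0#             ≈⟨ +-identityʳ 0# ⟩
      0#                  ∎))

    L-periodic : ∀ u → L (u + α) ≈ L u
    L-periodic u = trans (L-+ u α) (trans (+-congˡ L-α) (+-identityʳ _))

    K₀-periodic : ∀ u → K₀ (u + α) ≈ K₀ u
    K₀-periodic u = +-cong (L-periodic u) (*-congˡ (T-periodic u))

    T-on-cosets : ∀ {u v} → v ≈ u ⊎ v ≈ u + α → T v ≈ T u
    T-on-cosets (inj₁ v≈u)       = T-cong v≈u
    T-on-cosets {u} (inj₂ v≈u+α) = trans (T-cong v≈u+α) (T-periodic u)

    K₀-on-cosets : ∀ {u v} → v ≈ u ⊎ v ≈ u + α → K₀ v ≈ K₀ u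
    K₀-on-cosets {u} (inj₁ v≈u)   = K₀-cong v≈u
    K₀-on-cosets {u} (inj₂ v≈u+α) = trans (K₀-cong v≈u+α) (K₀-periodic u)

    K₀-+ : ∀ u v → K₀ u + K₀ v ≈ L (u + v) + γ * (T u + T v)
    K₀-+ u v = trans (+-interchange _ _ _ _) (+-cong (sym (L-+ u v)) (sym (distribˡ γ _ _)))

    L≈γc⇒c≈0 : ∀ {x c} → IsBit c → L x ≈ γ * c → c ≈ 0#
    L≈γc⇒c≈0         (inj₁ c≈0) _      = c≈0
    L≈γc⇒c≈0 {x} {c} (inj₂ c≈1) Lx≈γc = contradiction (trans Lx≈γc (trans (*-congˡ c≈1) (*-identityʳ γ))) (γ∉L x)

    -- L (u + v + w) ≈ γ c for a bit c; since γ ∉ im L, c ≈ 0 and u + v + w lies in ker L = {0, α}.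
    K₀-sum : ∀ {u v w b} → IsBit b → K₀ u + K₀ v ≈ L w + γ * b →
      (v ≈ u + w ⊎ v ≈ (u + w) + α) × T u + T (u + w) ≈ b
    K₀-sum {u} {v} {w} {b} b-bit sum≈ = v-cases , (begin
      T u + T (u + w)  ≈⟨ +-congˡ Tv≈T[u+w] ⟨
      T u + T v        ≈⟨ x+y≈0⇒x≈y c≈0 ⟩
      b                ∎)
      where
      c : Carrier
      c = (T u + T v) + b
      L[u+v+w]≈γc : L ((u + v) + w) ≈ γ * c
      L[u+v+w]≈γc = begin
        L ((u + v) + w)          ≈⟨ L-+ (u + v) w ⟩
        L (u + v) + L w          ≈⟨ x+y≈z+w⇒x+z≈y+w (trans (sym (K₀-+ u v)) sum≈) ⟩
        γ * (T u + T v) + γ * b  ≈⟨ distribˡ γ _ b ⟨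
        γ * c                    ∎
      c≈0 : c ≈ 0#
      c≈0 = L≈γc⇒c≈0 (IsBit-+ (IsBit-+ (Tr-isBit _) (Tr-isBit _)) b-bit) L[u+v+w]≈γc
      v-cases : v ≈ u + w ⊎ v ≈ (u + w) + α
      v-cases = Sum.map (x+y≈z⇒y≈x+z ∘ x+y≈0⇒x≈y)
        (λ u+v+w≈α → trans (x+y≈z⇒y≈x+z (x+y≈z⇒y≈x+z (trans (+-comm w _) u+v+w≈α))) (sym (+-assoc u w α)))
        (L-kernel (trans L[u+v+w]≈γc (trans (*-congˡ c≈0) (zeroʳ γ))))
      Tv≈T[u+w] : T v ≈ T (u + w)
      Tv≈T[u+w] = T-on-cosets v-cases

    K₀-fibre : ∀ {u v} → K₀ u ≈ K₀ v → v ≈ u ⊎ v ≈ u + α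
    K₀-fibre {u} {v} K₀u≈K₀v =
      Sum.map (λ v≈u+0 → trans v≈u+0 (+-identityʳ u)) (λ v≈u+0+α → trans v≈u+0+α (+-congʳ (+-identityʳ u)))
        (proj₁ (K₀-sum (inj₁ refl) K₀u+K₀v≈L0+γ0))
      where
      K₀u+K₀v≈L0+γ0 : K₀ u + K₀ v ≈ L 0# + γ * 0#
      K₀u+K₀v≈L0+γ0 = trans (+-congˡ (sym K₀u≈K₀v)) (trans (x+x≈0 _)
                        (sym (trans (+-cong L-0# (zeroʳ γ)) (+-identityʳ 0#))))

    S : Transversal (translation α≉0)
    S = transversal-exists isEquivalence size (translation α≉0)

    open Transversal S using () renaming (member to _∈S; Members to S-Members)

    HasSize-field : HasSize Carrier _≈_ (2 Nat.* 2 Nat.^ (2 Nat.* m))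
    HasSize-field = ≡.subst (HasSize Carrier _≈_) 2^n≡2*2^2m size

    HasSize-S : HasSize S-Members (_≈_ on proj₁) (2 Nat.^ (2 Nat.* m))
    HasSize-S = HasSize-transversal isEquivalence HasSize-field S

    ∈S-unique : ∀ {u v} → u ∈S → v ∈S → v ≈ u ⊎ v ≈ u + α → u ≈ v
    ∈S-unique = member-unique isEquivalence S

    K₀-injective-on-S : ∀ {u v} → u ∈S → v ∈S → K₀ u ≈ K₀ v → u ≈ v
    K₀-injective-on-S u∈S v∈S = ∈S-unique u∈S v∈S ∘ K₀-fibre

    Image : Carrier → Set
    Image y = ∃ λ x → K x ≈ y

    K₀∈Image : ∀ u → Image (K₀ u)
    K₀∈Image u = cbrt u , trans (K≈K₀∘cube (cbrt u)) (K₀-cong (cbrt-cube u))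

    Image-representative : ∀ {r} → Image r → ∃ λ u → u ∈S × K₀ u ≈ r
    Image-representative (x , Kx≈r) with representative isEquivalence S (pow x 3)
    ... | u , u∈S , u∈coset = u , u∈S , trans (K₀-on-cosets u∈coset) (trans (sym (K≈K₀∘cube x)) Kx≈r)

    HasSize-Image : HasSize (Σ Carrier Image) (_≈_ on proj₁) (2 Nat.^ (2 Nat.* m))
    HasSize-Image = HasSize-bijection trans HasSize-S (λ (u , _) → K₀ u , K₀∈Image u) K₀-cong
      (λ {(_ , u∈S)} {(_ , v∈S)} → K₀-injective-on-S u∈S v∈S) onto
      where
      onto : ∀ r → ∃ λ u → K₀ (proj₁ u) ≈ proj₁ r
      onto (r , r∈Image) with Image-representative r∈Image
      ... | u , u∈S , K₀u≈r = (u , u∈S) , K₀u≈r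

    -- im L has 2 ^ 2m elements and misses γ, so im L and γ + im L partition the field.
    L-cosets-cover : ∀ g → ∃ λ w → ∃ λ b → IsBit b × g ≈ L w + γ * b
    L-cosets-cover g = coset-of (HasSize-injective⇒surjective isEquivalence HasSize-S⊎S HasSize-field h
                                   (λ {x} {y} → h-injective {x} {y}) g)
      where
      2^2m : ℕ
      2^2m = 2 Nat.^ (2 Nat.* m)
      _≈ₛ⊎ₛ_ : Rel (S-Members ⊎ S-Members) 0ℓ
      _≈ₛ⊎ₛ_ = Pointwise (_≈_ on proj₁) (_≈_ on proj₁)
      HasSize-S⊎S : HasSize (S-Members ⊎ S-Members) _≈ₛ⊎ₛ_ (2 Nat.* 2 Nat.^ (2 Nat.* m))
      HasSize-S⊎S = ≡.subst (HasSize _ _≈ₛ⊎ₛ_) (≡.cong (2^2m Nat.+_) (≡.sym (ℕₚ.+-identityʳ 2^2m)))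
                      (HasSize-⊎ HasSize-S HasSize-S)
      h : S-Members ⊎ S-Members → Carrier
      h (inj₁ (u , _)) = L u
      h (inj₂ (u , _)) = L u + γ
      L[v+u]≈γ : ∀ {u v} → L u ≈ L v + γ → L (v + u) ≈ γ
      L[v+u]≈γ {u} {v} Lu≈Lv+γ = trans (L-+ v u) (trans (+-congˡ Lu≈Lv+γ) (x+[x+y]≈y (L v) γ))
      h-injective : ∀ {x y} → h x ≈ h y → x ≈ₛ⊎ₛ y
      h-injective {inj₁ (u , u∈S)} {inj₁ (v , v∈S)} Lu≈Lv     = inj₁ (∈S-unique u∈S v∈S (L-fibre Lu≈Lv))
      h-injective {inj₁ (u , _)}   {inj₂ (v , _)}   Lu≈Lv+γ   = contradiction (L[v+u]≈γ Lu≈Lv+γ) (γ∉L (v + u))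
      h-injective {inj₂ (u , _)}   {inj₁ (v , _)}   Lu+γ≈Lv   = contradiction (L[v+u]≈γ (sym Lu+γ≈Lv)) (γ∉L (u + v))
      h-injective {inj₂ (u , u∈S)} {inj₂ (v , v∈S)} Lu+γ≈Lv+γ =
        inj₂ (∈S-unique u∈S v∈S (L-fibre (+-cancelʳ Lu+γ≈Lv+γ)))
      coset-of : ∃ (λ x → h x ≈ g) → ∃ λ w → ∃ λ b → IsBit b × g ≈ L w + γ * b
      coset-of (inj₁ (w , _) , Lw≈g)   = w , 0# , inj₁ refl , sym (trans (+-congˡ (zeroʳ γ)) (trans (+-identityʳ _) Lw≈g))
      coset-of (inj₂ (w , _) , Lw+γ≈g) = w , 1# , inj₂ refl , sym (trans (+-congˡ (*-identityʳ γ)) Lw+γ≈g)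

    N : Carrier → Set
    N g = g ≈ 0# ⊎ g ≈ γ

    γ-multiple∈N : ∀ {c x} → IsBit c → x ≈ γ * c → N x
    γ-multiple∈N (inj₁ c≈0) x≈γc = inj₁ (trans x≈γc (trans (*-congˡ c≈0) (zeroʳ γ)))
    γ-multiple∈N (inj₂ c≈1) x≈γc = inj₂ (trans x≈γc (trans (*-congˡ c≈1) (*-identityʳ γ)))

    _≈ᵖ_ : ∀ {g} → Rel (DiffPairs +-abelianGroup Image g) 0ℓ
    d ≈ᵖ d′ = (proj₁ (proj₁ d) ≈ proj₁ (proj₁ d′)) × (proj₂ (proj₁ d) ≈ proj₂ (proj₁ d′))

    ≈ᵖ-trans : ∀ {g} → Transitive (_≈ᵖ_ {g})
    ≈ᵖ-trans (r≈s , r′≈s′) (s≈t , s′≈t′) = trans r≈s s≈t , trans r′≈s′ s′≈t′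

    DiffPair-representatives : ∀ {g} (d : DiffPairs +-abelianGroup Image g) →
      ∃ λ u → ∃ λ v → u ∈S × K₀ u ≈ proj₁ (proj₁ d) × K₀ v ≈ proj₂ (proj₁ d) × K₀ u + K₀ v ≈ g
    DiffPair-representatives ((r , r′) , r∈Image , r′∈Image , _ , r-r′≈g)
      with Image-representative r∈Image | Image-representative r′∈Image
    ... | u , u∈S , K₀u≈r | v , _ , K₀v≈r′ =
      u , v , u∈S , K₀u≈r , K₀v≈r′ , trans (+-cong K₀u≈r (trans K₀v≈r′ (sym (-x≈x r′)))) r-r′≈g

    K₀-+-shift : ∀ u w → K₀ u + K₀ (u + w) ≈ L w + γ * (T u + T (u + w))
    K₀-+-shift u w = trans (K₀-+ u (u + w)) (+-congʳ (L-cong (x+[x+y]≈y u w)))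

    module Differences (m≥1 : m Nat.≥ 1) {g : Carrier} (g∉N : ¬ N g) where

      w b : Carrier
      w = proj₁ (L-cosets-cover g)
      b = proj₁ (proj₂ (L-cosets-cover g))

      b-bit : IsBit b
      b-bit = proj₁ (proj₂ (proj₂ (L-cosets-cover g)))

      g≈Lw+γb : g ≈ L w + γ * b
      g≈Lw+γb = proj₂ (proj₂ (proj₂ (L-cosets-cover g)))

      Lw≉0 : ¬ L w ≈ 0#
      Lw≉0 Lw≈0 = g∉N (γ-multiple∈N b-bit (trans g≈Lw+γb (trans (+-congʳ Lw≈0) (+-identityˡ _))))

      ℓw≉0 : ¬ ℓ w ≈ 0#
      ℓw≉0 = ℓ-nonzero (λ w≈0 → Lw≉0 (trans (L-cong w≈0) L-0#)) (λ w≈α → Lw≉0 (trans (L-cong w≈α) L-α))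

      u₀ : Carrier
      u₀ = (β * α) * ℓ w ⁻¹

      Tr[ℓw*u₀]≈1 : Tr (ℓ w * u₀) ≈ 1#
      Tr[ℓw*u₀]≈1 = trans (Tr-cong (begin
        ℓ w * ((β * α) * ℓ w ⁻¹)   ≈⟨ x*[y*z]≈y*[x*z] (ℓ w) (β * α) (ℓ w ⁻¹) ⟩
        (β * α) * (ℓ w * ℓ w ⁻¹)   ≈⟨ *-congˡ (inverseʳ (ℓ w) ℓw≉0) ⟩
        (β * α) * 1#               ≈⟨ *-identityʳ _ ⟩
        β * α                      ∎)) Tr[βα]≈1

      u₀≉0 : ¬ u₀ ≈ 0#
      u₀≉0 u₀≈0 = 1≉0 (trans (sym Tr[ℓw*u₀]≈1) (trans (Tr-cong (trans (*-congˡ u₀≈0) (zeroʳ _))) Tr-0#))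

      Δ : Carrier → Carrier
      Δ u = T u + T (u + w)

      Δ-cong : ∀ {u v} → u ≈ v → Δ u ≈ Δ v
      Δ-cong u≈v = +-cong (T-cong u≈v) (T-cong (+-congʳ u≈v))

      Δ-isBit : ∀ u → IsBit (Δ u)
      Δ-isBit u = IsBit-+ (Tr-isBit _) (Tr-isBit _)

      Δ-shift : ∀ u → Δ (u + u₀) ≈ Δ u + 1#
      Δ-shift u = begin
        Δ (u + u₀)                            ≈⟨ T-derivative w (u + u₀) ⟩
        Tr (ℓ w * (u + u₀)) + T w             ≈⟨ +-congʳ (trans (Tr-cong (distribˡ (ℓ w) u u₀)) (Tr-+ _ _)) ⟩
        (Tr (ℓ w * u) + Tr (ℓ w * u₀)) + T w  ≈⟨ +-congʳ (+-congˡ Tr[ℓw*u₀]≈1) ⟩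
        (Tr (ℓ w * u) + 1#) + T w             ≈⟨ [x+y]+z≈[x+z]+y _ 1# (T w) ⟩
        (Tr (ℓ w * u) + T w) + 1#             ≈⟨ +-congʳ (T-derivative w u) ⟨
        Δ u + 1#                              ∎

      Δ-periodic : ∀ u → Δ (u + α) ≈ Δ u
      Δ-periodic u = +-cong (T-periodic u) (begin
        T ((u + α) + w)  ≈⟨ T-cong ([x+y]+z≈[x+z]+y u α w) ⟩
        T ((u + w) + α)  ≈⟨ T-periodic (u + w) ⟩
        T (u + w)        ∎)

      Z : Transversal (translation u₀≉0)
      Z = record
        { member      = λ u → Δ u ≈ b
        ; member?     = λ u → Δ u ≟ b
        ; member-resp = λ u≈v Δu≈b → trans (Δ-cong (sym u≈v)) Δu≈b
        ; exclusive   = λ u Δu≈b Δ[u+u₀]≈b →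
            x+1#≉x b (trans (+-congʳ (sym Δu≈b)) (trans (sym (Δ-shift u)) Δ[u+u₀]≈b))
        ; exhaustive  = λ u Δu≉b → trans (Δ-shift u) (IsBit-complement (Δ-isBit u) b-bit Δu≉b)
        }

      Z-periodic : ∀ {u} → Δ u ≈ b → Δ (u + α) ≈ b
      Z-periodic {u} = trans (Δ-periodic u)

      S∩Z : Transversal (restrict (translation α≉0) (Transversal.member Z) Z-periodic)
      S∩Z = Transversal-restrict (translation α≉0) (Transversal.member Z) Z-periodic S

      HasSize-S∩Z : HasSize (Transversal.Members S∩Z) (_≈_ on (proj₁ ∘ proj₁)) (2 Nat.^ (2 Nat.* m Nat.∸ 1))
      HasSize-S∩Z = HasSize-transversal (On.isEquivalence proj₁ isEquivalence)
        (≡.subst (HasSize (Transversal.Members Z) (_≈_ on proj₁)) (2^[2m]≡2*2^[2m∸1] m≥1)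
          (HasSize-transversal isEquivalence HasSize-field Z)) S∩Z

      K₀-pair-sum : ∀ {u} → Δ u ≈ b → K₀ u + K₀ (u + w) ≈ g
      K₀-pair-sum {u} Δu≈b = trans (K₀-+-shift u w) (trans (+-congˡ (*-congˡ Δu≈b)) (sym g≈Lw+γb))

      pair : Transversal.Members S∩Z → DiffPairs +-abelianGroup Image g
      pair ((u , Δu≈b) , _) = (K₀ u , K₀ (u + w)) , K₀∈Image u , K₀∈Image (u + w) , distinct ,
                              trans (+-congˡ (-x≈x _)) (K₀-pair-sum Δu≈b)
        where
        distinct : ¬ K₀ u ≈ K₀ (u + w)
        distinct K₀u≈K₀[u+w] =
          g∉N (inj₁ (trans (sym (K₀-pair-sum Δu≈b)) (trans (+-congˡ (sym K₀u≈K₀[u+w])) (x+x≈0 _))))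

      pair-onto : ∀ d → ∃ λ x → pair x ≈ᵖ d
      pair-onto d =
        let u , v , u∈S , K₀u≈r , K₀v≈r′ , K₀u+K₀v≈g = DiffPair-representatives d
            v∈coset , Δu≈b = K₀-sum b-bit (trans K₀u+K₀v≈g g≈Lw+γb)
        in ((u , Δu≈b) , u∈S) , K₀u≈r , trans (sym (K₀-on-cosets v∈coset)) K₀v≈r′

      pair-cong : ∀ {x y} → proj₁ (proj₁ x) ≈ proj₁ (proj₁ y) → pair x ≈ᵖ pair y
      pair-cong u≈v = K₀-cong u≈v , K₀-cong (+-congʳ u≈v)

      pair-injective : ∀ {x y} → pair x ≈ᵖ pair y → proj₁ (proj₁ x) ≈ proj₁ (proj₁ y)
      pair-injective {(_ , u∈S)} {(_ , v∈S)} (K₀u≈K₀v , _) = K₀-injective-on-S u∈S v∈S K₀u≈K₀v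

      HasSize-pairs : HasSize (DiffPairs +-abelianGroup Image g) _≈ᵖ_ (2 Nat.^ (2 Nat.* m Nat.∸ 1))
      HasSize-pairs = HasSize-bijection {_∼_ = _≈ᵖ_} (λ {x} {y} {z} → ≈ᵖ-trans {g} {x} {y} {z}) HasSize-S∩Z pair
        (λ {x} {y} → pair-cong {x} {y}) (λ {x} {y} → pair-injective {x} {y}) pair-onto

    HasSize-differences : m Nat.≥ 1 → ∀ g → ¬ N g →
      HasSize (DiffPairs +-abelianGroup Image g) _≈ᵖ_ (2 Nat.^ (2 Nat.* m Nat.∸ 1))
    HasSize-differences m≥1 g g∉N = Differences.HasSize-pairs m≥1 g∉N

    no-differences-in-N : ∀ g → N g → ¬ g ≈ 0# → ¬ DiffPairs +-abelianGroup Image g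
    no-differences-in-N g (inj₁ g≈0) g≉0 _ = g≉0 g≈0
    no-differences-in-N g (inj₂ g≈γ) _   d =
      let u , v , _ , _ , _ , K₀u+K₀v≈g = DiffPair-representatives d
          K₀u+K₀v≈L0+γ1 = trans K₀u+K₀v≈g (trans g≈γ (sym (trans (+-cong L-0# (*-identityʳ γ)) (+-identityˡ γ))))
      in 1≉0 (begin
        1#                ≈⟨ proj₂ (K₀-sum (inj₂ refl) K₀u+K₀v≈L0+γ1) ⟨
        T u + T (u + 0#)  ≈⟨ +-congˡ (T-cong (+-identityʳ u)) ⟩
        T u + T u         ≈⟨ x+x≈0 _ ⟩
        0#                ∎)

    N-+ : ∀ x y → N x → N y → N (x + y)
    N-+ x y (inj₁ x≈0) (inj₁ y≈0) = inj₁ (trans (+-cong x≈0 y≈0) (+-identityʳ 0#))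
    N-+ x y (inj₁ x≈0) (inj₂ y≈γ) = inj₂ (trans (+-cong x≈0 y≈γ) (+-identityˡ γ))
    N-+ x y (inj₂ x≈γ) (inj₁ y≈0) = inj₂ (trans (+-cong x≈γ y≈0) (+-identityʳ γ))
    N-+ x y (inj₂ x≈γ) (inj₂ y≈γ) = inj₁ (trans (+-cong x≈γ y≈γ) (x+x≈0 γ))

    N-resp : ∀ x y → x ≈ y → N x → N y
    N-resp x y x≈y (inj₁ x≈0) = inj₁ (trans (sym x≈y) x≈0)
    N-resp x y x≈y (inj₂ x≈γ) = inj₂ (trans (sym x≈y) x≈γ)

    N-neg : ∀ x → N x → N (- x)
    N-neg x = N-resp x (- x) (sym (-x≈x x))

    HasSize-N : HasSize (Σ Carrier N) (_≈_ on proj₁) 2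
    HasSize-N = enum , injective , onto
      where
      enum : Fin 2 → Σ Carrier N
      enum Fin.zero    = 0# , inj₁ refl
      enum (Fin.suc _) = γ , inj₂ refl
      injective : ∀ i j → proj₁ (enum i) ≈ proj₁ (enum j) → i ≡ j
      injective Fin.zero             Fin.zero             _   = ≡.refl
      injective Fin.zero             (Fin.suc Fin.zero)   0≈γ = contradiction (sym 0≈γ) γ≉0
      injective (Fin.suc Fin.zero)   Fin.zero             γ≈0 = contradiction γ≈0 γ≉0
      injective (Fin.suc Fin.zero)   (Fin.suc Fin.zero)   _   = ≡.refl
      onto : ∀ x → ∃ λ i → proj₁ (enum i) ≈ proj₁ x
      onto (_ , inj₁ x≈0) = Fin.zero , sym x≈0
      onto (_ , inj₂ x≈γ) = Fin.suc Fin.zero , sym x≈γ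

    Image-resp : ∀ x y → x ≈ y → Image x → Image y
    Image-resp x y x≈y (z , Kz≈x) = z , trans Kz≈x x≈y

    N-0# : N 0#
    N-0# = inj₁ refl

    HasSize-group : HasSize Carrier _≈_ (2 Nat.^ (2 Nat.* m) Nat.* 2)
    HasSize-group = ≡.subst (HasSize Carrier _≈_) (ℕₚ.*-comm 2 (2 Nat.^ (2 Nat.* m))) HasSize-field

mainTheorem5 :
  (m : ℕ) → m ≥ 1 →
  (F : Field2^ (2 Nat.* m Nat.+ 1)) →
  let open Field2^ F in
  (α β γ : Carrier) →
  ¬ (α ≈ 0#) → ¬ (β ≈ 0#) → ¬ (γ ≈ 0#) →
  (∀ x → ¬ ((pow x 2 + α * x) ≈ γ)) →
  Tr (β * α) ≈ 1# →
  let K : Carrier → Carrier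
      K x = pow x 6 + α * pow x 3 + γ * Tr (pow (α ⁻¹) 3 * pow x 9 + β * pow x 3)
  in IsRelDiffSet +-abelianGroup
       (2 Nat.^ (2 Nat.* m)) 2 (2 Nat.^ (2 Nat.* m)) (2 Nat.^ (2 Nat.* m ∸ 1))
       (λ g → (g ≈ 0#) ⊎ (g ≈ γ))
       (λ y → ∃ λ x → K x ≈ y)
mainTheorem5 m m≥1 F α β γ α≉0 _ γ≉0 γ∉L Tr[βα]≈1 =
  HasSize-group , N-0# , N-+ , N-neg , N-resp , HasSize-N ,
  Image-resp , HasSize-Image , HasSize-differences m≥1 , no-differences-in-N
  where open Construction m F α β γ α≉0 γ≉0 γ∉L Tr[βα]≈1
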